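{- Let $s\ge 2$ and $t$ be integers. The set $\Omega(s,t)$ of all integers distinguished with respect to $(s,t)$ is the union of an infinite collection of arithmetic progressions of the form $\{a+dm: m=0,1,2,\dots\}$ with $a,d$ positive integers.
   Context: For integers $s$ and $r\ge 1$ with $\gcd(r,s)=1$, $\operatorname{ord}_r(s)$ denotes the least positive integer $m$ with $s^m\equiv 1\pmod r$. For integers $s\ge 2$ and $t$, an integer $r\ge 2$ is distinguished with respect to $(s,t)$ if $\gcd(r,s)=1$ and $r$ divides $t\cdot\frac{s^{\operatorname{ord}_r(s)}-1}{s-1}$. -}

module Defs where

open import Data.Nat using (ℕ; zero; suc; _+_; _*_; _∸_; _^_; _≤_; _<_)
open import Data.Nat.DivMod using (_/_)
open import Data.Nat.GCD using (gcd)
import Data.Nat.Divisibility as ℕD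
open import Data.Integer using (ℤ; +_) renaming (_*_ to _*ℤ_)
open import Data.Integer.Divisibility using () renaming (_∣_ to _∣ℤ_)
open import Data.Product using (_×_; ∃)
open import Relation.Binary.PropositionalEquality using (_≡_)

-- (s^m - 1)/(s - 1), literally as integer division.  Only meaningful for
-- s ≥ 2 (the standing assumption); for s ∈ {0,1} it is set to 0 arbitrarily.
geomQuot : ℕ → ℕ → ℕ
geomQuot zero          m = 0
geomQuot (suc zero)    m = 0
geomQuot (suc (suc k)) m = (suc (suc k) ^ m ∸ 1) / suc k

-- s^m ≡ 1 (mod r), written as r ∣ s^m - 1 (valid since s ≥ 1 ⇒ s^m ≥ 1)
PowOne : ℕ → ℕ → ℕ → Set
PowOne r s m = r ℕD.∣ (s ^ m ∸ 1)

IsOrd : ℕ → ℕ → ℕ → Set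
IsOrd r s m = 1 ≤ m × PowOne r s m × (∀ k → 1 ≤ k → PowOne r s k → m ≤ k)

Distinguished : ℕ → ℤ → ℕ → Set
Distinguished s t r =
  2 ≤ r × gcd r s ≡ 1 ×
  ∃ λ m → IsOrd r s m × ((+ r) ∣ℤ (t *ℤ (+ geomQuot s m)))

module Submission where

-- If r is distinguished with m = ord_r(s) and w ≡ 1 (mod r s (s - 1)), then r w is distinguished:
-- M = ord_{rw}(s) is a multiple of m, so (s^m - 1)/(s - 1) divides (s^M - 1)/(s - 1), and so does w,
-- being coprime to s - 1.  Hence each distinguished r starts a progression r + r²s(s - 1)ℕ inside
-- Ω(s,t).  As s + 1 is distinguished (of order 2), the progressions from s + 1 with periods scaled by
-- 2, 3, … make the family infinite; it can be indexed by ℕ since being distinguished is decidable.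

open import Defs
open import Data.Nat
open import Data.Nat.Properties
open import Data.Nat.Divisibility
open import Data.Nat.DivMod using (_/_; _%_; m%n<n; m≡m%n+[m/n]*n; m*n/n≡m)
open import Data.Nat.Coprimality as Coprime
  using (Coprime; coprime-divisor; coprime⇒gcd≡1; gcd≡1⇒coprime; coprime-+; 1-coprimeTo)
open import Data.Nat.GCD using (gcd)
open import Data.Nat.LCM using (lcm; lcm-least; gcd*lcm)
open import Data.Nat.Induction using (<-rec)
open import Data.Nat.Solver using (module +-*-Solver)
open import Data.Integer as ℤ using (ℤ; ∣_∣) renaming (_*_ to _*ℤ_)
open import Data.Integer.Divisibility using () renaming (_∣_ to _∣ℤ_)
open import Data.Integer.Properties using (abs-*)
open import Data.Fin using (toℕ; fromℕ<)
open import Data.Fin.Properties using (pigeonhole; toℕ-fromℕ<)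
open import Data.Product
open import Function.Base using (_∘_)
open import Function.Bundles using (_⇔_; mk⇔; Equivalence)
open import Relation.Nullary using (Dec; yes; no; ¬_; contradiction)
open import Relation.Nullary.Decidable using (_×-dec_)
open import Relation.Unary using (Pred; Decidable)
open import Relation.Binary.PropositionalEquality
open +-*-Solver

coprime-*ʳ : ∀ {r a b} → Coprime r a → Coprime r b → Coprime r (a * b)
coprime-*ʳ ca cb (d∣r , d∣ab) =
  cb (d∣r , coprime-divisor (λ (e∣d , e∣a) → ca (∣-trans e∣d d∣r , e∣a)) d∣ab)

coprime-^ʳ : ∀ {r s} → Coprime r s → ∀ n → Coprime r (s ^ n)
coprime-^ʳ {r} c zero    = Coprime.sym (1-coprimeTo r)
coprime-^ʳ     c (suc n) = coprime-*ʳ c (coprime-^ʳ c n)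

coprime-1+ : ∀ {n y} → y ∣ n → Coprime (1 + n) y
coprime-1+ {n} y∣n {d} (d∣1+n , d∣y) =
  ∣1⇒≡1 (∣m+n∣m⇒∣n (subst (d ∣_) (+-comm 1 n) d∣1+n) (∣-trans d∣y y∣n))

coprime-∣⇒*-∣ : ∀ {m n c} → Coprime m n → m ∣ c → n ∣ c → m * n ∣ c
coprime-∣⇒*-∣ {m} {n} {c} cop m∣c n∣c = subst (_∣ c) lcm≡* (lcm-least m∣c n∣c)
  where
  lcm≡* : lcm m n ≡ m * n
  lcm≡* = trans (sym (*-identityˡ (lcm m n)))
                (trans (cong (_* lcm m n) (sym (coprime⇒gcd≡1 cop))) (gcd*lcm m n))

%-≡⇒∣∸ : ∀ x y r .{{_ : NonZero r}} → x % r ≡ y % r → r ∣ y ∸ x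
%-≡⇒∣∸ x y r eq = divides (y / r ∸ x / r) (begin
  y ∸ x                                      ≡⟨ cong₂ _∸_ (m≡m%n+[m/n]*n y r) (m≡m%n+[m/n]*n x r) ⟩
  (y % r + y / r * r) ∸ (x % r + x / r * r)  ≡⟨ cong (λ z → (z + y / r * r) ∸ (x % r + x / r * r)) (sym eq) ⟩
  (x % r + y / r * r) ∸ (x % r + x / r * r)  ≡⟨ [m+n]∸[m+o]≡n∸o (x % r) _ _ ⟩
  y / r * r ∸ x / r * r                      ≡⟨ sym (*-distribʳ-∸ r (y / r) (x / r)) ⟩
  (y / r ∸ x / r) * r                        ∎)
  where open ≡-Reasoning

least-witness : ∀ {p} {P : Pred ℕ p} → Decidable P →
                ∀ n → P n → ∃ λ m → P m × (∀ {k} → k < m → ¬ P k)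
least-witness {P = P} P? = <-rec (λ n → P n → ∃ λ m → P m × (∀ {k} → k < m → ¬ P k)) step
  where
  step : ∀ n → (∀ {k} → k < n → P k → ∃ λ m → P m × (∀ {j} → j < m → ¬ P j)) →
         P n → ∃ λ m → P m × (∀ {k} → k < m → ¬ P k)
  step n below pn with anyUpTo? P? n
  ... | yes (k , k<n , pk) = below k<n pk
  ... | no none            = n , pn , λ k<n pk → none (_ , k<n , pk)

geom : ℕ → ℕ → ℕ
geom s zero    = 0
geom s (suc n) = 1 + s * geom s n

geom-+ : ∀ s a b → geom s (a + b) ≡ geom s a + s ^ a * geom s b
geom-+ s zero    b = sym (+-identityʳ (geom s b))
geom-+ s (suc a) b rewrite geom-+ s a b =
  solve 4 (λ s ga pa gb → con 1 :+ s :* (ga :+ pa :* gb) := (con 1 :+ s :* ga) :+ s :* pa :* gb)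
        refl s (geom s a) (s ^ a) (geom s b)

geom-∣-geom-* : ∀ s a q → geom s a ∣ geom s (q * a)
geom-∣-geom-* s a zero    = geom s a ∣0
geom-∣-geom-* s a (suc q) rewrite geom-+ s a (q * a) =
  ∣m∣n⇒∣m+n ∣-refl (∣n⇒∣m*n (s ^ a) (geom-∣-geom-* s a q))

geom-2 : ∀ s → geom s 2 ≡ 1 + s
geom-2 s = cong suc (trans (cong (λ z → s * suc z) (*-zeroʳ s)) (*-identityʳ s))

^∸1≡[∸1]*geom : ∀ s n → s ^ n ∸ 1 ≡ (s ∸ 1) * geom s n
^∸1≡[∸1]*geom zero    zero    = refl
^∸1≡[∸1]*geom zero    (suc n) = refl
^∸1≡[∸1]*geom (suc p) n       = cong (_∸ 1) (^≡1+*geom n)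
  where
  ^≡1+*geom : ∀ n → suc p ^ n ≡ 1 + p * geom (suc p) n
  ^≡1+*geom zero    = cong suc (sym (*-zeroʳ p))
  ^≡1+*geom (suc n) rewrite ^≡1+*geom n =
    solve 2 (λ p g → (con 1 :+ p) :* (con 1 :+ p :* g) := con 1 :+ p :* (con 1 :+ (con 1 :+ p) :* g))
          refl p (geom (suc p) n)

^-+-∸1 : ∀ s a b → s ^ (a + b) ∸ 1 ≡ (s ^ a ∸ 1) + s ^ a * (s ^ b ∸ 1)
^-+-∸1 s a b = begin
  s ^ (a + b) ∸ 1                                    ≡⟨ ^∸1≡[∸1]*geom s (a + b) ⟩
  (s ∸ 1) * geom s (a + b)                           ≡⟨ cong ((s ∸ 1) *_) (geom-+ s a b) ⟩
  (s ∸ 1) * (geom s a + s ^ a * geom s b)            ≡⟨ solve 4 (λ u ga pa gb → u :* (ga :+ pa :* gb)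
                                                                          := u :* ga :+ pa :* (u :* gb))
                                                              refl (s ∸ 1) (geom s a) (s ^ a) (geom s b) ⟩
  (s ∸ 1) * geom s a + s ^ a * ((s ∸ 1) * geom s b)  ≡⟨ cong₂ (λ x y → x + s ^ a * y)
                                                              (^∸1≡[∸1]*geom s a) (^∸1≡[∸1]*geom s b) ⟨
  (s ^ a ∸ 1) + s ^ a * (s ^ b ∸ 1)                  ∎
  where open ≡-Reasoning

geomQuot≡geom : ∀ {s} → 2 ≤ s → ∀ m → geomQuot s m ≡ geom s m
geomQuot≡geom {suc (suc k)} (s≤s (s≤s z≤n)) m =
  trans (cong (_/ suc k) (^∸1≡[∸1]*geom (suc (suc k)) m))
        (trans (cong (_/ suc k) (*-comm (suc k) (geom (suc (suc k)) m))) (m*n/n≡m _ (suc k)))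

module _ {r s : ℕ} where

  PowOne-+ : ∀ {a b} → PowOne r s a → PowOne r s b → PowOne r s (a + b)
  PowOne-+ {a} {b} pa pb = subst (r ∣_) (sym (^-+-∸1 s a b)) (∣m∣n⇒∣m+n pa (∣n⇒∣m*n (s ^ a) pb))

  PowOne-∸ : ∀ {a b} → Coprime r s → PowOne r s a → PowOne r s (a + b) → PowOne r s b
  PowOne-∸ {a} {b} c pa pab =
    coprime-divisor (coprime-^ʳ c a) (∣m+n∣m⇒∣n (subst (r ∣_) (^-+-∸1 s a b) pab) pa)

  PowOne-* : ∀ {a} → PowOne r s a → ∀ q → PowOne r s (q * a)
  PowOne-* pa zero    = r ∣0
  PowOne-* {a} pa (suc q) = PowOne-+ {a} {q * a} pa (PowOne-* pa q)

  PowOne-exists : .{{NonZero r}} → Coprime r s → ∃ λ n → 1 ≤ n × PowOne r s n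
  PowOne-exists c with pigeonhole (n<1+n r) (λ i → fromℕ< (m%n<n (s ^ toℕ i) r))
  ... | i , j , i<j , same-residue = b ∸ a , m<n⇒0<n∸m i<j , coprime-divisor (coprime-^ʳ c a) r∣
    where
    a = toℕ i
    b = toℕ j
    r∣ : r ∣ s ^ a * (s ^ (b ∸ a) ∸ 1)
    r∣ = subst (r ∣_) (begin
      s ^ b ∸ s ^ a                       ≡⟨ cong (λ z → s ^ z ∸ s ^ a) (sym (m+[n∸m]≡n (<⇒≤ i<j))) ⟩
      s ^ (a + (b ∸ a)) ∸ s ^ a           ≡⟨ cong₂ _∸_ (^-distribˡ-+-* s a (b ∸ a)) (sym (*-identityʳ (s ^ a))) ⟩
      s ^ a * s ^ (b ∸ a) ∸ s ^ a * 1     ≡⟨ sym (*-distribˡ-∸ (s ^ a) (s ^ (b ∸ a)) 1) ⟩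
      s ^ a * (s ^ (b ∸ a) ∸ 1)           ∎)
      (%-≡⇒∣∸ (s ^ a) (s ^ b) r (begin
        s ^ a % r                         ≡⟨ toℕ-fromℕ< (m%n<n (s ^ a) r) ⟨
        toℕ (fromℕ< (m%n<n (s ^ a) r))    ≡⟨ cong toℕ same-residue ⟩
        toℕ (fromℕ< (m%n<n (s ^ b) r))    ≡⟨ toℕ-fromℕ< (m%n<n (s ^ b) r) ⟩
        s ^ b % r                         ∎))
      where open ≡-Reasoning

  IsOrd-exists : .{{NonZero r}} → Coprime r s → ∃ (IsOrd r s)
  IsOrd-exists c with PowOne-exists c
  ... | n , pn with least-witness (λ k → 1 ≤? k ×-dec r ∣? s ^ k ∸ 1) n pn
  ...   | m , (1≤m , pm) , minimal =
    m , 1≤m , pm , λ k 1≤k pk → ≮⇒≥ (λ k<m → minimal k<m (1≤k , pk))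

  IsOrd-unique : ∀ {m m′} → IsOrd r s m → IsOrd r s m′ → m ≡ m′
  IsOrd-unique (1≤m , pm , least) (1≤m′ , pm′ , least′) = ≤-antisym (least _ 1≤m′ pm′) (least′ _ 1≤m pm)

  IsOrd-∣ : ∀ {m n} → Coprime r s → IsOrd r s m → PowOne r s n → m ∣ n
  IsOrd-∣ {m} {n} c (1≤m , pm , least) pn = m%n≡0⇒n∣m n m (remainder≡0 (n % m) (m%n<n n m) p-rem)
    where
    instance
      m≢0 : NonZero m
      m≢0 = >-nonZero 1≤m
    p-rem : PowOne r s (n % m)
    p-rem = PowOne-∸ {n / m * m} c (PowOne-* pm (n / m))
                     (subst (PowOne r s) (trans (m≡m%n+[m/n]*n n m) (+-comm (n % m) _)) pn)
    remainder≡0 : ∀ k → k < m → PowOne r s k → k ≡ 0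
    remainder≡0 zero    _   _  = refl
    remainder≡0 (suc k) k<m pk = contradiction (least (suc k) (s≤s z≤n) pk) (<⇒≱ k<m)

module _ {s : ℕ} (2≤s : 2 ≤ s) (t : ℤ) where

  ∣ℤ⇔∣geom : ∀ r m → (ℤ.+ r) ∣ℤ (t *ℤ (ℤ.+ geomQuot s m)) ⇔ r ∣ ∣ t ∣ * geom s m
  ∣ℤ⇔∣geom r m = mk⇔ (subst (r ∣_) eq) (subst (r ∣_) (sym eq))
    where
    eq : ∣ t *ℤ (ℤ.+ geomQuot s m) ∣ ≡ ∣ t ∣ * geom s m
    eq = trans (abs-* t (ℤ.+ geomQuot s m)) (cong (∣ t ∣ *_) (geomQuot≡geom 2≤s m))

  distinguished? : ∀ r → Dec (Distinguished s t r)
  distinguished? r with 2 ≤? r | gcd r s ≟ 1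
  ... | no r≱2 | _      = no (r≱2 ∘ proj₁)
  ... | yes _  | no g≢1 = no (g≢1 ∘ proj₁ ∘ proj₂)
  ... | yes 2≤r | yes g≡1 with IsOrd-exists ⦃ ≢-nonZero (m<n⇒n≢0 2≤r) ⦄ (gcd≡1⇒coprime g≡1)
  ...   | m , ord-m with r ∣? ∣ t *ℤ (ℤ.+ geomQuot s m) ∣
  ...     | yes r∣ = yes (2≤r , g≡1 , m , ord-m , r∣)
  ...     | no r∤  = no λ (_ , _ , m′ , ord-m′ , r∣′) →
                       r∤ (subst (λ k → (ℤ.+ r) ∣ℤ (t *ℤ (ℤ.+ geomQuot s k))) (IsOrd-unique ord-m′ ord-m) r∣′)

  Distinguished-*ʳ : ∀ {r w} → 1 ≤ w → Coprime w r → Coprime w s → Coprime w (s ∸ 1) →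
                     Distinguished s t r → Distinguished s t (r * w)
  Distinguished-*ʳ {r} {w} 1≤w w⊥r w⊥s w⊥s-1 (2≤r , g≡1 , m , ord-m , r∣t*geomQuot) =
    from-order (proj₂ (IsOrd-exists ⦃ m*n≢0 r w ⦄ rw⊥s))
    where
    instance
      r≢0 : NonZero r
      r≢0 = ≢-nonZero (m<n⇒n≢0 2≤r)
      w≢0 : NonZero w
      w≢0 = >-nonZero 1≤w
    r⊥s : Coprime r s
    r⊥s = gcd≡1⇒coprime g≡1
    rw⊥s : Coprime (r * w) s
    rw⊥s = Coprime.sym (coprime-*ʳ (Coprime.sym r⊥s) (Coprime.sym w⊥s))
    from-order : ∀ {M} → IsOrd (r * w) s M → Distinguished s t (r * w)
    from-order {M} ord-M@(_ , rw∣s^M∸1 , _) =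
      ≤-trans 2≤r (m≤m*n r w) , coprime⇒gcd≡1 rw⊥s , M , ord-M ,
      Equivalence.from (∣ℤ⇔∣geom (r * w) M) (coprime-∣⇒*-∣ (Coprime.sym w⊥r) r∣ w∣)
      where
      geom-m∣geom-M : geom s m ∣ geom s M
      geom-m∣geom-M with IsOrd-∣ {n = M} r⊥s ord-m (∣-trans (m∣m*n w) rw∣s^M∸1)
      ... | divides q M≡q*m = subst (λ k → geom s m ∣ geom s k) (sym M≡q*m) (geom-∣-geom-* s m q)
      r∣ : r ∣ ∣ t ∣ * geom s M
      r∣ = ∣-trans (Equivalence.to (∣ℤ⇔∣geom r m) r∣t*geomQuot) (*-monoʳ-∣ ∣ t ∣ geom-m∣geom-M)
      w∣ : w ∣ ∣ t ∣ * geom s M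
      w∣ = ∣n⇒∣m*n ∣ t ∣ (coprime-divisor w⊥s-1
             (subst (w ∣_) (^∸1≡[∸1]*geom s M) (∣-trans (n∣m*n r) rw∣s^M∸1)))

  period : ℕ → ℕ
  period r = r * (r * (s * (s ∸ 1)))

  Distinguished-progression : ∀ {r} → Distinguished s t r → ∀ m → Distinguished s t (r + period r * m)
  Distinguished-progression {r} dist m =
    subst (Distinguished s t) r*w≡ (Distinguished-*ʳ (s≤s z≤n) (w-coprime (m∣m*n _))
          (w-coprime (∣n⇒∣m*n r (m∣m*n (s ∸ 1)))) (w-coprime (∣n⇒∣m*n r (n∣m*n s))) dist)
    where
    w-coprime : ∀ {y} → y ∣ r * (s * (s ∸ 1)) → Coprime (1 + r * (s * (s ∸ 1)) * m) y
    w-coprime y∣ = coprime-1+ (∣m⇒∣m*n m y∣)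
    r*w≡ : r * (1 + r * (s * (s ∸ 1)) * m) ≡ r + period r * m
    r*w≡ = solve 3 (λ r n m → r :* (con 1 :+ r :* n :* m) := r :+ r :* (r :* n) :* m)
                   refl r (s * (s ∸ 1)) m

  Distinguished-suc : Distinguished s t (suc s)
  Distinguished-suc =
    s≤s (≤-trans (s≤s z≤n) 2≤s) , coprime⇒gcd≡1 suc-s⊥s , 2 , (s≤s z≤n , pow-2 , minimal) ,
    Equivalence.from (∣ℤ⇔∣geom (suc s) 2) (subst (λ g → suc s ∣ ∣ t ∣ * g) (sym (geom-2 s)) (n∣m*n ∣ t ∣))
    where
    suc-s⊥s : Coprime (suc s) s
    suc-s⊥s = subst (λ n → Coprime n s) (+-comm s 1) (coprime-+ (1-coprimeTo s))
    pow-2 : PowOne (suc s) s 2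
    pow-2 = subst (suc s ∣_) (sym (trans (^∸1≡[∸1]*geom s 2) (cong ((s ∸ 1) *_) (geom-2 s))))
                  (n∣m*n (s ∸ 1))
    -- s - 1 lies strictly between 0 and s + 1
    minimal : ∀ k → 1 ≤ k → PowOne (suc s) s k → 2 ≤ k
    minimal (suc zero) _ p =
      contradiction (∣⇒≤ ⦃ >-nonZero (m<n⇒0<n∸m 2≤s) ⦄ (subst (suc s ∣_) (cong (_∸ 1) (*-identityʳ s)) p))
                    (<⇒≱ (s≤s (m∸n≤m s 1)))
    minimal (suc (suc k)) _ _ = s≤s (s≤s z≤n)

-- Index i names the progression starting at i if i is distinguished; otherwise it names one of the
-- infinitely many progressions starting at s + 1, told apart by their multiplier i + 2 ≠ 1.
module Progressions {s : ℕ} (2≤s : 2 ≤ s) (t : ℤ) where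

  start : ℕ → ℕ
  start i with distinguished? 2≤s t i
  ... | yes _ = i
  ... | no _  = suc s

  multiplier : ℕ → ℕ
  multiplier i with distinguished? 2≤s t i
  ... | yes _ = 1
  ... | no _  = 2 + i

  difference : ℕ → ℕ
  difference i = period 2≤s t (start i) * multiplier i

  start-distinguished : ∀ i → Distinguished s t (start i)
  start-distinguished i with distinguished? 2≤s t i
  ... | yes dist = dist
  ... | no _     = Distinguished-suc 2≤s t

  start-self : ∀ {r} → Distinguished s t r → start r ≡ r
  start-self {r} dist with distinguished? 2≤s t r
  ... | yes _    = refl
  ... | no ¬dist = contradiction dist ¬dist

  start-multiplier-injective : ∀ i j → start i ≡ start j → multiplier i ≡ multiplier j → i ≡ j
  start-multiplier-injective i j with distinguished? 2≤s t i | distinguished? 2≤s t j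
  ... | yes _ | yes _ = λ i≡j _ → i≡j
  ... | yes _ | no _  = λ _ ()
  ... | no _  | yes _ = λ _ ()
  ... | no _  | no _  = λ _ → suc-injective ∘ suc-injective

  start-positive : ∀ i → 1 ≤ start i
  start-positive i = ≤-trans (s≤s z≤n) (proj₁ (start-distinguished i))

  period-positive : ∀ i → 1 ≤ period 2≤s t (start i)
  period-positive i = *-mono-≤ (start-positive i)
    (*-mono-≤ (start-positive i) (*-mono-≤ (≤-trans (s≤s z≤n) 2≤s) (m<n⇒0<n∸m 2≤s)))

  multiplier-positive : ∀ i → 1 ≤ multiplier i
  multiplier-positive i with distinguished? 2≤s t i
  ... | yes _ = s≤s z≤n
  ... | no _  = s≤s z≤n

  start-difference-injective : ∀ i j → start i ≡ start j → difference i ≡ difference j → i ≡ j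
  start-difference-injective i j start≡ difference≡ = start-multiplier-injective i j start≡
    (*-cancelˡ-≡ (multiplier i) (multiplier j) (period 2≤s t (start i)) ⦃ >-nonZero (period-positive i) ⦄
      (trans difference≡ (cong (λ r → period 2≤s t r * multiplier j) (sym start≡))))

  Distinguished⇔on-progression : ∀ r → Distinguished s t r ⇔ (∃ λ i → ∃ λ m → r ≡ start i + difference i * m)
  Distinguished⇔on-progression r = mk⇔
    (λ dist → r , 0 , sym (trans (cong (start r +_) (*-zeroʳ (difference r)))
                                 (trans (+-identityʳ (start r)) (start-self dist))))
    (λ (i , m , r≡) → subst (Distinguished s t)
       (trans (cong (start i +_) (sym (*-assoc (period 2≤s t (start i)) (multiplier i) m))) (sym r≡))
       (Distinguished-progression 2≤s t (start-distinguished i) (multiplier i * m)))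

corollary3p7 : (s : ℕ) → 2 ≤ s → (t : ℤ) →
    Σ (ℕ → ℕ) λ a → Σ (ℕ → ℕ) λ d →
      (∀ i → 1 ≤ a i × 1 ≤ d i) ×
      (∀ i j → a i ≡ a j → d i ≡ d j → i ≡ j) ×
      (∀ r → Distinguished s t r ⇔ (∃ λ i → ∃ λ m → r ≡ a i + d i * m))
corollary3p7 s 2≤s t =
  start , difference ,
  (λ i → start-positive i , *-mono-≤ (period-positive i) (multiplier-positive i)) ,
  start-difference-injective , Distinguished⇔on-progression
  where open Progressions 2≤s t
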